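{- For all $n\ge4$, $\chi(\mathsf{D}_n)=\chi\!\left(\tfrac12 H_n\right)$, where $\chi(\tfrac12H_n)$ denotes the chromatic number of the vertex-edge graph of the half cube $\tfrac12H_n$.
   Context: $\mathsf{D}_n=\{x\in\mathbb{Z}^n:\sum_k x_k \text{ even}\}$. The half cube is the polytope $\tfrac12H_n=\mathrm{conv}\{x\in\{0,1\}^n : \sum_k x_k\equiv 0 \bmod 2\}$; its vertex-edge graph has the vertices of this polytope as vertices and its edges (one-dimensional faces) as edges. For a full-rank lattice $\Lambda$, $V(\Lambda)=\{x:\|x\|\le\|x-v\|\ \forall v\in\Lambda\}$ is the Voronoi cell; $u\in\Lambda\setminus\{0\}$ is a strict Voronoi vector if $(u+V(\Lambda))\cap V(\Lambda)$ is a facet of $V(\Lambda)$ (equivalently $\pm u$ are the only shortest vectors of $u+2\Lambda$); $\chi(\Lambda)$ is the chromatic number of the Cayley graph on $\Lambda$ with $v,w$ adjacent iff $v-w$ is a strict Voronoi vector. -}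

module Defs where

open import Data.Nat using (ℕ)
open import Data.Fin using (Fin)
open import Data.Integer using (ℤ; +_; _+_; _*_; _-_; -_; _≤_; _<_)
open import Data.Integer.Divisibility using (_∣_)
open import Data.Vec using (Vec; foldr′; zipWith; map)
open import Data.Vec.Relation.Unary.All using (All)
open import Data.Product using (Σ; ∃; ∃-syntax; _×_)
open import Data.Sum using (_⊎_)
open import Relation.Nullary using (¬_)
open import Relation.Binary.PropositionalEquality using (_≡_; _≢_)

Pt : ℕ → Set
Pt n = Vec ℤ n

sumℤ : ∀ {n} → Pt n → ℤ
sumℤ = foldr′ _+_ (+ 0)

_·_ : ∀ {n} → Pt n → Pt n → ℤ
x · y = sumℤ (zipWith _*_ x y)

normSq : ∀ {n} → Pt n → ℤ
normSq x = x · x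

_⊕_ : ∀ {n} → Pt n → Pt n → Pt n
_⊕_ = zipWith _+_

_⊖_ : ∀ {n} → Pt n → Pt n → Pt n
_⊖_ = zipWith _-_

neg : ∀ {n} → Pt n → Pt n
neg = map (λ a → - a)

scale : ∀ {n} → ℤ → Pt n → Pt n
scale k = map (k *_)

zeroPt : ∀ {n} → Pt n
zeroPt = Data.Vec.replicate _ (+ 0)

InD : ∀ {n} → Pt n → Set
InD x = + 2 ∣ sumℤ x

StrictVoronoiD : ∀ {n} → Pt n → Set
StrictVoronoiD {n} u =
  InD u × u ≢ zeroPt ×
  (∀ (v : Pt n) → InD v →
     normSq u ≤ normSq (u ⊕ scale (+ 2) v) ×
     (normSq (u ⊕ scale (+ 2) v) ≡ normSq u →
        (u ⊕ scale (+ 2) v) ≡ u ⊎ (u ⊕ scale (+ 2) v) ≡ neg u))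

AdjD : ∀ {n} → Pt n → Pt n → Set
AdjD v w = StrictVoronoiD (v ⊖ w)

-- The half cube ½H_n = conv {x ∈ {0,1}^n : Σ x_k even}

IsBit : ℤ → Set
IsBit a = a ≡ + 0 ⊎ a ≡ + 1

HGen : ∀ {n} → Pt n → Set
HGen x = All IsBit x × InD x

HVertex : ∀ {n} → Pt n → Set
HVertex {n} x =
  HGen x × ∃[ c ] ∃[ δ ] (c · x ≡ δ ×
    (∀ (z : Pt n) → HGen z → (c · z ≤ δ) × (c · z ≡ δ → z ≡ x)))

-- {x,y} spans an edge (1-dimensional face) of ½H_n: x ≠ y are generating
-- points and some supporting hyperplane c·_ = δ (c·_ ≤ δ on the polytope)
-- meets the generating set exactly in {x, y}, so the face is the segment [x,y].
HEdge : ∀ {n} → Pt n → Pt n → Set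
HEdge {n} x y =
  x ≢ y × HGen x × HGen y × ∃[ c ] ∃[ δ ] (c · x ≡ δ × c · y ≡ δ ×
    (∀ (z : Pt n) → HGen z → (c · z ≤ δ) × (c · z ≡ δ → z ≡ x ⊎ z ≡ y)))

Colorable : ∀ {V : Set} → (V → Set) → (V → V → Set) → ℕ → Set
Colorable {V} Vert Adj k =
  Σ (V → Fin k) λ col →
    ∀ x y → Vert x → Vert y → Adj x y → col x ≢ col y

ColorableD : ℕ → ℕ → Set
ColorableD n k = Colorable {Pt n} InD AdjD k

ColorableHalfCube : ℕ → ℕ → Set
ColorableHalfCube n k = Colorable {Pt n} HVertex HEdge k

{-# OPTIONS --safe #-}

-- The strict Voronoi vectors of Dₙ (n ≥ 2) are exactly its roots ±eᵢ ± eⱼ (i ≠ j). For a root u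
-- every entry a lies in {0, ±1}, so (a + 2b)² ≥ a² with equality only if a + 2b = ±a; since v ∈ Dₙ
-- has even coordinate sum, u + 2v cannot flip the sign of just one of the two nonzero entries of u,
-- so ±u are the only shortest vectors of u + 2Dₙ. Conversely, if u is strict Voronoi, comparing u
-- with u + 2(a eᵢ + b eⱼ), where a, b ∈ {±1} have signs opposite to uᵢ and uⱼ, shows |uᵢ| + |uⱼ| ≤ 2,
-- with equality only if u + 2(a eᵢ + b eⱼ) = −u; with u ≠ 0 and Σ u even this forces u to be a root.
-- Two vertices of ½Hₙ span an edge exactly when they differ in two coordinates, i.e. when their
-- difference is a root. So a proper colouring of Dₙ restricts to ½Hₙ, and a proper colouring of ½Hₙ
-- pulls back along the coordinatewise parity map Dₙ → ½Hₙ, which sends points differing by a root to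
-- points differing in exactly two coordinates.

module Submission where

open import Defs
open import Data.Nat as ℕ using (ℕ; zero; suc)
open import Data.Nat.Divisibility using (∣1⇒≡1)
open import Data.Fin using (Fin; zero; suc)
import Data.Fin.Properties as Finₚ
open import Data.Integer as ℤ using (ℤ; +_; -[1+_]; _+_; _*_; _-_; -_; _≤_; ∣_∣; +≤+; -≤+)
import Data.Integer.Properties as ℤₚ
import Data.Integer.Divisibility.Signed as Signed
open import Data.Integer.DivMod using (_%ℕ_; _/ℕ_; n%ℕd<d; a≡a%ℕn+[a/ℕn]*n)
open import Data.Integer.Tactic.RingSolver using (solve-∀)
open import Data.Vec using (Vec; []; _∷_; lookup; _[_]≔_; zipWith; map)
import Data.Vec.Properties as Vecₚ
open import Data.Vec.Relation.Binary.Pointwise.Extensional using (ext; Pointwise-≡⇒≡)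
open import Data.Vec.Relation.Unary.All using (All)
open import Data.Vec.Relation.Unary.All.Properties using (lookup⁺; lookup⁻)
open import Data.Product using (∃-syntax; _×_; _,_; proj₁; proj₂)
open import Data.Sum using (_⊎_; inj₁; inj₂)
open import Data.Empty using (⊥-elim)
open import Function using (_∘_)
open import Relation.Nullary using (¬_; Dec; yes; no)
open import Relation.Nullary.Decidable using (¬?; _→-dec_; decidable-stable)
open import Relation.Binary.PropositionalEquality

private variable
  n : ℕ
  A : Set
  a b : ℤ
  i j : Fin n


lookup-ext : {x y : Vec A n} → (∀ m → lookup x m ≡ lookup y m) → x ≡ y
lookup-ext x≗y = Pointwise-≡⇒≡ (ext x≗y)

EqualExcept : Fin n → Vec A n → Vec A n → Set
EqualExcept i x y = ∀ m → m ≢ i → lookup x m ≡ lookup y m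

EqualExcept₂ : Fin n → Fin n → Vec A n → Vec A n → Set
EqualExcept₂ i j x y = ∀ m → m ≢ i → m ≢ j → lookup x m ≡ lookup y m

SupportedOn : Fin n → Pt n → Set
SupportedOn i x = ∀ m → m ≢ i → lookup x m ≡ + 0

SupportedOn₂ : Fin n → Fin n → Pt n → Set
SupportedOn₂ i j x = ∀ m → m ≢ i → m ≢ j → lookup x m ≡ + 0

∀-split₂ : {P : Fin n → Set} → P i → P j → (∀ m → m ≢ i → m ≢ j → P m) → ∀ m → P m
∀-split₂ {i = i} {j} pᵢ pⱼ pₘ m with m Finₚ.≟ i | m Finₚ.≟ j
... | yes refl | _        = pᵢ
... | no _     | yes refl = pⱼ
... | no m≢i   | no m≢j   = pₘ m m≢i m≢j

∃¬-except : {P : Fin n → Set} → (∀ m → Dec (P m)) → ¬ (∀ m → m ≢ i → P m) → ∃[ j ] j ≢ i × ¬ P j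
∃¬-except {n} {i} P? ¬∀P with Finₚ.¬∀⟶∃¬ n _ (λ m → ¬? (m Finₚ.≟ i) →-dec P? m) ¬∀P
... | j , ¬[j≢i→Pj] =
  j , (λ j≡i → ¬[j≢i→Pj] λ j≢i → ⊥-elim (j≢i j≡i)) , (λ Pj → ¬[j≢i→Pj] λ _ → Pj)

lookup∘update₂ˡ : ∀ (x : Vec A n) {i j} {s t : A} → i ≢ j → lookup (x [ i ]≔ s [ j ]≔ t) i ≡ s
lookup∘update₂ˡ x {i} {j} {s} {t} i≢j =
  trans (Vecₚ.lookup∘update′ i≢j (x [ i ]≔ s) t) (Vecₚ.lookup∘update i x s)

lookup∘update₂ʳ : ∀ (x : Vec A n) {i j} {s t : A} → lookup (x [ i ]≔ s [ j ]≔ t) j ≡ t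
lookup∘update₂ʳ x {i} {j} {s} {t} = Vecₚ.lookup∘update j (x [ i ]≔ s) t

update₂-equalExcept₂ : ∀ (x : Vec A n) {i j} {s t : A} → EqualExcept₂ i j (x [ i ]≔ s [ j ]≔ t) x
update₂-equalExcept₂ x {i} {j} {s} {t} m m≢i m≢j =
  trans (Vecₚ.lookup∘update′ m≢j (x [ i ]≔ s) t) (Vecₚ.lookup∘update′ m≢i x s)

lookup-zeroPt : ∀ (m : Fin n) → lookup zeroPt m ≡ + 0
lookup-zeroPt m = Vecₚ.lookup-replicate m (+ 0)

lookup-⊖ : ∀ (x y : Pt n) m → lookup (x ⊖ y) m ≡ lookup x m - lookup y m
lookup-⊖ x y m = Vecₚ.lookup-zipWith _-_ m x y

+-mono-≤-≡ : ∀ {p q r s} → p ≤ q → r ≤ s → p + r ≡ q + s → p ≡ q × r ≡ s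
+-mono-≤-≡ p≤q r≤s eq =
  ≤∧≮⇒≡ p≤q (λ p<q → ℤₚ.<-irrefl eq (ℤₚ.+-mono-<-≤ p<q r≤s)) ,
  ≤∧≮⇒≡ r≤s (λ r<s → ℤₚ.<-irrefl eq (ℤₚ.+-mono-≤-< p≤q r<s))
  where
  ≤∧≮⇒≡ : ∀ {p q} → p ≤ q → ¬ p ℤ.< q → p ≡ q
  ≤∧≮⇒≡ p≤q p≮q = ℤₚ.≤-antisym p≤q (ℤₚ.≮⇒≥ p≮q)

sumℤ-mono-≤ : (x y : Pt n) → (∀ m → lookup x m ≤ lookup y m) → sumℤ x ≤ sumℤ y
sumℤ-mono-≤ []      []      _   = ℤₚ.≤-refl
sumℤ-mono-≤ (_ ∷ x) (_ ∷ y) x≤y = ℤₚ.+-mono-≤ (x≤y zero) (sumℤ-mono-≤ x y (x≤y ∘ suc))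

sumℤ-mono-≤-≡ : (x y : Pt n) → (∀ m → lookup x m ≤ lookup y m) → sumℤ x ≡ sumℤ y →
                ∀ m → lookup x m ≡ lookup y m
sumℤ-mono-≤-≡ (p ∷ x) (q ∷ y) x≤y eq = λ where
    zero    → proj₁ heads-tails
    (suc m) → sumℤ-mono-≤-≡ x y (x≤y ∘ suc) (proj₂ heads-tails) m
  where
  heads-tails : p ≡ q × sumℤ x ≡ sumℤ y
  heads-tails = +-mono-≤-≡ (x≤y zero) (sumℤ-mono-≤ x y (x≤y ∘ suc)) eq

sumℤ-equalExcept : (x y : Pt n) → EqualExcept i x y → sumℤ x - sumℤ y ≡ lookup x i - lookup y i
sumℤ-equalExcept {i = zero} (p ∷ x) (q ∷ y) x≈y =
  subst (λ s → (p + sumℤ s) - (q + sumℤ y) ≡ p - q) (sym (lookup-ext {x = x} {y} λ m → x≈y (suc m) λ ()))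
    (cancelʳ p q (sumℤ y))
  where
  cancelʳ : ∀ p q s → (p + s) - (q + s) ≡ p - q
  cancelʳ = solve-∀
sumℤ-equalExcept {i = suc i} (p ∷ x) (q ∷ y) x≈y rewrite x≈y zero (λ ()) =
  trans (cancelˡ q (sumℤ x) (sumℤ y)) (sumℤ-equalExcept x y λ m m≢i → x≈y (suc m) (m≢i ∘ Finₚ.suc-injective))
  where
  cancelˡ : ∀ q s t → (q + s) - (q + t) ≡ s - t
  cancelˡ = solve-∀

sumℤ-equalExcept₂ : (x y : Pt n) → i ≢ j → EqualExcept₂ i j x y →
                    sumℤ x - sumℤ y ≡ (lookup x i - lookup y i) + (lookup x j - lookup y j)
sumℤ-equalExcept₂ {i = i} {j} x y i≢j x≈y = begin
  sumℤ x - sumℤ y                                        ≡⟨ through (sumℤ x) (sumℤ z) (sumℤ y) ⟩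
  (sumℤ x - sumℤ z) + (sumℤ z - sumℤ y)                  ≡⟨ cong₂ _+_ (sumℤ-equalExcept x z x≈z)
                                                                      (sumℤ-equalExcept z y z≈y) ⟩
  (lookup x i - lookup z i) + (lookup z j - lookup y j)  ≡⟨ cong₂ (λ p q → (lookup x i - p) + (q - lookup y j))
                                                                  zᵢ zⱼ ⟩
  (lookup x i - lookup y i) + (lookup x j - lookup y j)  ∎
  where
  open ≡-Reasoning
  through : ∀ p q r → p - r ≡ (p - q) + (q - r)
  through = solve-∀
  z : Pt _
  z = x [ i ]≔ lookup y i
  zᵢ : lookup z i ≡ lookup y i
  zᵢ = Vecₚ.lookup∘update i x _
  zⱼ : lookup z j ≡ lookup x j
  zⱼ = Vecₚ.lookup∘update′ (i≢j ∘ sym) x _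
  x≈z : EqualExcept i x z
  x≈z m m≢i = sym (Vecₚ.lookup∘update′ m≢i x _)
  z≈y : EqualExcept j z y
  z≈y m m≢j with m Finₚ.≟ i
  ... | yes refl = zᵢ
  ... | no m≢i   = trans (Vecₚ.lookup∘update′ m≢i x _) (x≈y m m≢i m≢j)

sumℤ-zeroPt : sumℤ (zeroPt {n}) ≡ + 0
sumℤ-zeroPt {zero}  = refl
sumℤ-zeroPt {suc n} = trans (ℤₚ.+-identityˡ _) (sumℤ-zeroPt {n})

sumℤ-supportedOn : (x : Pt n) → SupportedOn i x → sumℤ x ≡ lookup x i
sumℤ-supportedOn {n} {i} x supp = begin
  sumℤ x                          ≡⟨ ℤₚ.+-identityʳ (sumℤ x) ⟨
  sumℤ x - + 0                    ≡⟨ cong (λ s → sumℤ x - s) (sumℤ-zeroPt {n}) ⟨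
  sumℤ x - sumℤ (zeroPt {n})      ≡⟨ sumℤ-equalExcept x zeroPt x≈0 ⟩
  lookup x i - lookup zeroPt i    ≡⟨ cong (λ p → lookup x i - p) (lookup-zeroPt i) ⟩
  lookup x i - + 0                ≡⟨ ℤₚ.+-identityʳ (lookup x i) ⟩
  lookup x i                      ∎
  where
  open ≡-Reasoning
  x≈0 : EqualExcept i x zeroPt
  x≈0 m m≢i = trans (supp m m≢i) (sym (lookup-zeroPt m))

sumℤ-supportedOn₂ : (x : Pt n) → i ≢ j → SupportedOn₂ i j x → sumℤ x ≡ lookup x i + lookup x j
sumℤ-supportedOn₂ {n} {i} {j} x i≢j supp = begin
  sumℤ x                                     ≡⟨ ℤₚ.+-identityʳ (sumℤ x) ⟨
  sumℤ x - + 0                               ≡⟨ cong (λ s → sumℤ x - s) (sumℤ-zeroPt {n}) ⟨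
  sumℤ x - sumℤ (zeroPt {n})                 ≡⟨ sumℤ-equalExcept₂ x zeroPt i≢j x≈0 ⟩
  (lookup x i - lookup zeroPt i) + (lookup x j - lookup zeroPt j)
    ≡⟨ cong₂ (λ p q → (lookup x i - p) + (lookup x j - q)) (lookup-zeroPt i) (lookup-zeroPt j) ⟩
  (lookup x i - + 0) + (lookup x j - + 0)    ≡⟨ cong₂ _+_ (ℤₚ.+-identityʳ (lookup x i))
                                                            (ℤₚ.+-identityʳ (lookup x j)) ⟩
  lookup x i + lookup x j                    ∎
  where
  open ≡-Reasoning
  x≈0 : EqualExcept₂ i j x zeroPt
  x≈0 m m≢i m≢j = trans (supp m m≢i m≢j) (sym (lookup-zeroPt m))

·-distribˡ-⊕ : (c x y : Pt n) → c · (x ⊕ y) ≡ c · x + c · y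
·-distribˡ-⊕ []       []       []       = refl
·-distribˡ-⊕ (c ∷ cs) (x ∷ xs) (y ∷ ys) =
  trans (cong (λ s → c * (x + y) + s) (·-distribˡ-⊕ cs xs ys)) (regroup c x y (cs · xs) (cs · ys))
  where
  regroup : ∀ c x y s t → c * (x + y) + (s + t) ≡ (c * x + s) + (c * y + t)
  regroup = solve-∀


Even : ℤ → Set
Even = Signed._∣_ (+ 2)

InD⇒Even : (x : Pt n) → InD x → Even (sumℤ x)
InD⇒Even x = Signed.∣ᵤ⇒∣

Even⇒InD : (x : Pt n) → Even (sumℤ x) → InD x
Even⇒InD x = Signed.∣⇒∣ᵤ

even-by-difference : Even (a - b) → Even b → Even a
even-by-difference {a} {b} 2∣a-b 2∣b = subst Even (cancel a b) (Signed.∣m∣n⇒∣m+n 2∣a-b 2∣b)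
  where
  cancel : ∀ a b → (a - b) + b ≡ a
  cancel = solve-∀

sumℤ-difference-even : (x y : Pt n) → (∀ m → Even (lookup x m - lookup y m)) → Even (sumℤ x - sumℤ y)
sumℤ-difference-even []      []      _        = Signed.divides (+ 0) refl
sumℤ-difference-even (p ∷ x) (q ∷ y) x-y-even = subst Even (sym (regroup p q (sumℤ x) (sumℤ y)))
  (Signed.∣m∣n⇒∣m+n (x-y-even zero) (sumℤ-difference-even x y (x-y-even ∘ suc)))
  where
  regroup : ∀ p q s t → (p + s) - (q + t) ≡ (p - q) + (s - t)
  regroup = solve-∀

InD-equalExcept-even : (x y : Pt n) → InD x → InD y → EqualExcept i x y → Even (lookup x i - lookup y i)
InD-equalExcept-even x y x∈D y∈D x≈y =
  subst Even (sumℤ-equalExcept x y x≈y) (Signed.∣m∣n⇒∣m-n (InD⇒Even x x∈D) (InD⇒Even y y∈D))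

InD-equalExcept₂-even : (x y : Pt n) → InD x → InD y → i ≢ j → EqualExcept₂ i j x y →
                        Even ((lookup x i - lookup y i) + (lookup x j - lookup y j))
InD-equalExcept₂-even x y x∈D y∈D i≢j x≈y =
  subst Even (sumℤ-equalExcept₂ x y i≢j x≈y) (Signed.∣m∣n⇒∣m-n (InD⇒Even x x∈D) (InD⇒Even y y∈D))

IsUnit : ℤ → Set
IsUnit a = a ≡ + 1 ⊎ a ≡ - + 1

unit-odd : IsUnit a → ¬ Even a
unit-odd (inj₁ refl) 2∣1  with ∣1⇒≡1 (Signed.∣⇒∣ᵤ 2∣1)
... | ()
unit-odd (inj₂ refl) 2∣-1 with ∣1⇒≡1 (Signed.∣⇒∣ᵤ 2∣-1)
... | ()

unit+unit-even : IsUnit a → IsUnit b → Even (a + b)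
unit+unit-even (inj₁ refl) (inj₁ refl) = Signed.divides (+ 1) refl
unit+unit-even (inj₁ refl) (inj₂ refl) = Signed.divides (+ 0) refl
unit+unit-even (inj₂ refl) (inj₁ refl) = Signed.divides (+ 0) refl
unit+unit-even (inj₂ refl) (inj₂ refl) = Signed.divides (- + 1) refl

¬Even-0+unit : a ≡ + 0 → IsUnit b → ¬ Even (a + b)
¬Even-0+unit {b = b} refl b-unit = unit-odd b-unit ∘ subst Even (ℤₚ.+-identityˡ b)

¬Even-unit+0 : IsUnit a → b ≡ + 0 → ¬ Even (a + b)
¬Even-unit+0 {a} a-unit refl = unit-odd a-unit ∘ subst Even (ℤₚ.+-identityʳ a)

unit-neg : IsUnit a → IsUnit (- a)
unit-neg (inj₁ refl) = inj₂ refl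
unit-neg (inj₂ refl) = inj₁ refl

unit-square : IsUnit a → a * a ≡ + 1
unit-square (inj₁ refl) = refl
unit-square (inj₂ refl) = refl

unit-nonzero : IsUnit a → a ≢ + 0
unit-nonzero (inj₁ refl) ()
unit-nonzero (inj₂ refl) ()

∣x∣≡1⇒unit : ∀ x → ∣ x ∣ ≡ 1 → IsUnit x
∣x∣≡1⇒unit (+ 1)    _ = inj₁ refl
∣x∣≡1⇒unit -[1+ 0 ] _ = inj₂ refl

self-neg⇒0 : ∀ x → x ≡ - x → x ≡ + 0
self-neg⇒0 (+ zero) _ = refl

square-nonneg : ∀ c → + 0 ≤ c * c
square-nonneg (+ zero)  = +≤+ ℕ.z≤n
square-nonneg (+ suc _) = +≤+ ℕ.z≤n
square-nonneg -[1+ _ ]  = +≤+ ℕ.z≤n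

square-pos : ∀ c → c ≢ + 0 → + 1 ≤ c * c
square-pos (+ zero)  c≢0 = ⊥-elim (c≢0 refl)
square-pos (+ suc _) _   = +≤+ (ℕ.s≤s ℕ.z≤n)
square-pos -[1+ _ ]  _   = +≤+ (ℕ.s≤s ℕ.z≤n)

square≡0⇒0 : ∀ c → c * c ≡ + 0 → c ≡ + 0
square≡0⇒0 (+ zero) _ = refl

square≡1⇒unit : ∀ c → c * c ≡ + 1 → IsUnit c
square≡1⇒unit (+ 1)           _ = inj₁ refl
square≡1⇒unit -[1+ 0 ]        _ = inj₂ refl
square≡1⇒unit (+ suc (suc k)) ()
square≡1⇒unit -[1+ suc k ]    ()

shift-injective : ∀ a {b c} → a + + 2 * b ≡ a + + 2 * c → b ≡ c
shift-injective a {b} {c} eq = ℤₚ.*-cancelˡ-≡ (+ 2) b c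
  (trans (recover a b) (trans (cong (λ s → s - a) eq) (sym (recover a c))))
  where
  recover : ∀ a b → + 2 * b ≡ (a + + 2 * b) - a
  recover = solve-∀

unit-shift-nonzero : IsUnit a → ∀ b → a + + 2 * b ≢ + 0
unit-shift-nonzero a-unit b eq = unit-odd a-unit
  (Signed.∣m+n∣n⇒∣m (subst Even (sym eq) (Signed.divides (+ 0) refl)) (Signed.∣m⇒∣m*n b Signed.∣-refl))

small-shift-square-≤ : ∀ b → a ≡ + 0 ⊎ IsUnit a → a * a ≤ (a + + 2 * b) * (a + + 2 * b)
small-shift-square-≤ b (inj₁ refl)        = square-nonneg (+ 0 + + 2 * b)
small-shift-square-≤ {a} b (inj₂ a-unit) = subst (_≤ (a + + 2 * b) * (a + + 2 * b)) (sym (unit-square a-unit))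
  (square-pos (a + + 2 * b) (unit-shift-nonzero a-unit b))

small-shift-square-≡ : ∀ b → a ≡ + 0 ⊎ IsUnit a →
                       (a + + 2 * b) * (a + + 2 * b) ≡ a * a → b ≡ + 0 ⊎ b ≡ - a
small-shift-square-≡ b (inj₁ refl) eq = inj₁ (shift-injective (+ 0) (square≡0⇒0 (+ 0 + + 2 * b) eq))
small-shift-square-≡ b (inj₂ (inj₁ refl)) eq with square≡1⇒unit (+ 1 + + 2 * b) eq
... | inj₁ eq′ = inj₁ (shift-injective (+ 1) eq′)
... | inj₂ eq′ = inj₂ (shift-injective (+ 1) eq′)
small-shift-square-≡ b (inj₂ (inj₂ refl)) eq with square≡1⇒unit (- + 1 + + 2 * b) eq
... | inj₁ eq′ = inj₂ (shift-injective (- + 1) eq′)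
... | inj₂ eq′ = inj₁ (shift-injective (- + 1) eq′)

unit-shift-square-gap : ∀ u → IsUnit a → (u + + 2 * a) * (u + + 2 * a) - u * u ≡ + 4 * (a * u + + 1)
unit-shift-square-gap {a} u a-unit = begin
  (u + + 2 * a) * (u + + 2 * a) - u * u  ≡⟨ expand a u ⟩
  + 4 * (a * u + a * a)                  ≡⟨ cong (λ t → + 4 * (a * u + t)) (unit-square a-unit) ⟩
  + 4 * (a * u + + 1)                    ∎
  where
  open ≡-Reasoning
  expand : ∀ a u → (u + + 2 * a) * (u + + 2 * a) - u * u ≡ + 4 * (a * u + a * a)
  expand = solve-∀


-- Roots of Dₙ are strict Voronoi vectors

_+2·_ : Pt n → Pt n → Pt n
u +2· v = u ⊕ scale (+ 2) v

squares : Pt n → Pt n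
squares x = zipWith _*_ x x

IsRoot : Pt n → Set
IsRoot {n} u = ∃[ i ] ∃[ j ] i ≢ j × IsUnit (lookup u i) × IsUnit (lookup u j) × SupportedOn₂ i j u

lookup-+2· : ∀ (u v : Pt n) m → lookup (u +2· v) m ≡ lookup u m + + 2 * lookup v m
lookup-+2· u v m =
  trans (Vecₚ.lookup-zipWith _+_ m u _) (cong (λ s → lookup u m + s) (Vecₚ.lookup-map m (+ 2 *_) v))

lookup-squares : ∀ (x : Pt n) m → lookup (squares x) m ≡ lookup x m * lookup x m
lookup-squares x m = Vecₚ.lookup-zipWith _*_ m x x

lookup-squares-+2· : ∀ (u v : Pt n) m → lookup (squares (u +2· v)) m ≡
                     (lookup u m + + 2 * lookup v m) * (lookup u m + + 2 * lookup v m)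
lookup-squares-+2· u v m = trans (lookup-squares (u +2· v) m) (cong (λ t → t * t) (lookup-+2· u v m))

+2·-vanishing : (u v : Pt n) → (∀ m → lookup v m ≡ + 0) → u +2· v ≡ u
+2·-vanishing u v v≗0 = lookup-ext λ m →
  trans (lookup-+2· u v m) (trans (cong (λ t → lookup u m + + 2 * t) (v≗0 m)) (ℤₚ.+-identityʳ (lookup u m)))

+2·-negated : (u v : Pt n) → (∀ m → lookup v m ≡ - lookup u m) → u +2· v ≡ neg u
+2·-negated u v v≗-u = lookup-ext λ m → begin
  lookup (u +2· v) m                  ≡⟨ lookup-+2· u v m ⟩
  lookup u m + + 2 * lookup v m       ≡⟨ cong (λ t → lookup u m + + 2 * t) (v≗-u m) ⟩
  lookup u m + + 2 * (- lookup u m)   ≡⟨ reflect (lookup u m) ⟩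
  - lookup u m                        ≡⟨ Vecₚ.lookup-map m -_ u ⟨
  lookup (neg u) m                    ∎
  where
  open ≡-Reasoning
  reflect : ∀ a → a + + 2 * (- a) ≡ - a
  reflect = solve-∀

root-InD : (u : Pt n) → IsRoot u → InD u
root-InD u (i , j , i≢j , uᵢ , uⱼ , supp) =
  Even⇒InD u (subst Even (sym (sumℤ-supportedOn₂ u i≢j supp)) (unit+unit-even uᵢ uⱼ))

root-nonzero : (u : Pt n) → IsRoot u → u ≢ zeroPt
root-nonzero u (i , _ , _ , uᵢ , _) u≡0 =
  unit-nonzero uᵢ (trans (cong (λ x → lookup x i) u≡0) (lookup-zeroPt i))

root-coordinate : (u : Pt n) → IsRoot u → ∀ m → lookup u m ≡ + 0 ⊎ IsUnit (lookup u m)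
root-coordinate u (i , j , _ , uᵢ , uⱼ , supp) =
  ∀-split₂ (inj₂ uᵢ) (inj₂ uⱼ) (λ m m≢i m≢j → inj₁ (supp m m≢i m≢j))

root-squares-≤ : (u v : Pt n) → IsRoot u → ∀ m → lookup (squares u) m ≤ lookup (squares (u +2· v)) m
root-squares-≤ u v root m = subst₂ _≤_ (sym (lookup-squares u m)) (sym (lookup-squares-+2· u v m))
  (small-shift-square-≤ (lookup v m) (root-coordinate u root m))

root-coset-≤ : (u v : Pt n) → IsRoot u → normSq u ≤ normSq (u +2· v)
root-coset-≤ u v root = sumℤ-mono-≤ (squares u) (squares (u +2· v)) (root-squares-≤ u v root)

root-coset-≡ : (u v : Pt n) → IsRoot u → InD v → normSq (u +2· v) ≡ normSq u →
               u +2· v ≡ u ⊎ u +2· v ≡ neg u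
root-coset-≡ u v root@(i , j , i≢j , uᵢ , uⱼ , supp) v∈D eq = conclude (choice i) (choice j)
  where
  choice : ∀ m → lookup v m ≡ + 0 ⊎ lookup v m ≡ - lookup u m
  choice m = small-shift-square-≡ (lookup v m) (root-coordinate u root m) (begin
    (lookup u m + + 2 * lookup v m) * (lookup u m + + 2 * lookup v m)  ≡⟨ lookup-squares-+2· u v m ⟨
    lookup (squares (u +2· v)) m                                       ≡⟨ squares-equal m ⟨
    lookup (squares u) m                                               ≡⟨ lookup-squares u m ⟩
    lookup u m * lookup u m                                            ∎)
    where
    open ≡-Reasoning
    squares-equal : ∀ m → lookup (squares u) m ≡ lookup (squares (u +2· v)) m
    squares-equal = sumℤ-mono-≤-≡ (squares u) (squares (u +2· v)) (root-squares-≤ u v root) (sym eq)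

  v-supp : SupportedOn₂ i j v
  v-supp m m≢i m≢j with choice m
  ... | inj₁ vₘ≡0   = vₘ≡0
  ... | inj₂ vₘ≡-uₘ = trans vₘ≡-uₘ (cong -_ (supp m m≢i m≢j))

  v-parity : Even (lookup v i + lookup v j)
  v-parity = subst Even (sumℤ-supportedOn₂ v i≢j v-supp) (InD⇒Even v v∈D)

  conclude : lookup v i ≡ + 0 ⊎ lookup v i ≡ - lookup u i → lookup v j ≡ + 0 ⊎ lookup v j ≡ - lookup u j →
             u +2· v ≡ u ⊎ u +2· v ≡ neg u
  conclude (inj₁ vᵢ) (inj₁ vⱼ) = inj₁ (+2·-vanishing u v (∀-split₂ vᵢ vⱼ v-supp))
  conclude (inj₂ vᵢ) (inj₂ vⱼ) = inj₂ (+2·-negated u v (∀-split₂ vᵢ vⱼ λ m m≢i m≢j →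
    trans (v-supp m m≢i m≢j) (cong -_ (sym (supp m m≢i m≢j)))))
  conclude (inj₁ vᵢ) (inj₂ vⱼ) = ⊥-elim (¬Even-0+unit vᵢ (subst IsUnit (sym vⱼ) (unit-neg uⱼ)) v-parity)
  conclude (inj₂ vᵢ) (inj₁ vⱼ) = ⊥-elim (¬Even-unit+0 (subst IsUnit (sym vᵢ) (unit-neg uᵢ)) vⱼ v-parity)

root⇒strictVoronoi : (u : Pt n) → IsRoot u → StrictVoronoiD u
root⇒strictVoronoi u root =
  root-InD u root , root-nonzero u root , λ v v∈D → root-coset-≤ u v root , root-coset-≡ u v root v∈D


-- For n ≥ 2, strict Voronoi vectors of Dₙ are roots

opposing-unit : ∀ x → x ≢ + 0 → ∃[ a ] ∃[ k ] IsUnit a × ∣ x ∣ ≡ suc k × a * x ≡ -[1+ k ]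
opposing-unit (+ zero)  x≢0 = ⊥-elim (x≢0 refl)
opposing-unit (+ suc k) _   = - + 1 , k , inj₂ refl , refl , ℤₚ.-1*i≡-i (+ suc k)
opposing-unit -[1+ k ]  _   = + 1 , k , inj₁ refl , refl , ℤₚ.*-identityˡ -[1+ k ]

opposed-gaps-nonneg : ∀ k l → + 0 ≤ (-[1+ k ] + + 1) + (-[1+ l ] + + 1) → k ≡ 0 × l ≡ 0
opposed-gaps-nonneg zero    zero    _  = refl , refl
opposed-gaps-nonneg zero    (suc l) ()
opposed-gaps-nonneg (suc k) zero    ()
opposed-gaps-nonneg (suc k) (suc l) ()

even-opposed-gap : ∀ k → Even (+ suc k) → + 0 ≤ (-[1+ k ] + + 1) + + 1 → (-[1+ k ] + + 1) + + 1 ≡ + 0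
even-opposed-gap zero          2∣1 _ = ⊥-elim (unit-odd (inj₁ refl) 2∣1)
even-opposed-gap (suc zero)    _   _ = refl
even-opposed-gap (suc (suc k)) _   ()

module TestVector (u : Pt n) {i j : Fin n} (i≢j : i ≢ j) {a b : ℤ} (a-unit : IsUnit a) (b-unit : IsUnit b)
  where

  v : Pt n
  v = zeroPt [ i ]≔ a [ j ]≔ b

  w : Pt n
  w = u +2· v

  gap : ℤ
  gap = (a * lookup u i + + 1) + (b * lookup u j + + 1)

  v-supp : SupportedOn₂ i j v
  v-supp m m≢i m≢j = trans (update₂-equalExcept₂ (zeroPt {n}) m m≢i m≢j) (lookup-zeroPt m)

  v∈D : InD v
  v∈D = Even⇒InD v (subst Even (sym v-sum) (unit+unit-even a-unit b-unit))
    where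
    v-sum : sumℤ v ≡ a + b
    v-sum = trans (sumℤ-supportedOn₂ v i≢j v-supp)
      (cong₂ _+_ (lookup∘update₂ˡ (zeroPt {n}) i≢j) (lookup∘update₂ʳ (zeroPt {n})))

  wᵢ : lookup w i ≡ lookup u i + + 2 * a
  wᵢ = trans (lookup-+2· u v i) (cong (λ t → lookup u i + + 2 * t) (lookup∘update₂ˡ (zeroPt {n}) i≢j))

  wⱼ : lookup w j ≡ lookup u j + + 2 * b
  wⱼ = trans (lookup-+2· u v j) (cong (λ t → lookup u j + + 2 * t) (lookup∘update₂ʳ (zeroPt {n})))

  w≈u : EqualExcept₂ i j w u
  w≈u m m≢i m≢j = trans (lookup-+2· u v m)
    (trans (cong (λ t → lookup u m + + 2 * t) (v-supp m m≢i m≢j)) (ℤₚ.+-identityʳ (lookup u m)))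

  normSq-gap : normSq w - normSq u ≡ + 4 * gap
  normSq-gap = begin
    normSq w - normSq u
      ≡⟨ sumℤ-equalExcept₂ (squares w) (squares u) i≢j squares-w≈u ⟩
    (lookup (squares w) i - lookup (squares u) i) + (lookup (squares w) j - lookup (squares u) j)
      ≡⟨ cong₂ _+_ (gap-at i wᵢ a-unit) (gap-at j wⱼ b-unit) ⟩
    + 4 * (a * lookup u i + + 1) + + 4 * (b * lookup u j + + 1)
      ≡⟨ ℤₚ.*-distribˡ-+ (+ 4) (a * lookup u i + + 1) (b * lookup u j + + 1) ⟨
    + 4 * gap  ∎
    where
    open ≡-Reasoning
    squares-w≈u : EqualExcept₂ i j (squares w) (squares u)
    squares-w≈u m m≢i m≢j = trans (lookup-squares w m)
      (trans (cong (λ t → t * t) (w≈u m m≢i m≢j)) (sym (lookup-squares u m)))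
    gap-at : ∀ m {c} → lookup w m ≡ lookup u m + + 2 * c → IsUnit c →
             lookup (squares w) m - lookup (squares u) m ≡ + 4 * (c * lookup u m + + 1)
    gap-at m wₘ c-unit = trans (cong₂ _-_ (lookup-squares w m) (lookup-squares u m))
      (trans (cong (λ t → t * t - lookup u m * lookup u m) wₘ) (unit-shift-square-gap (lookup u m) c-unit))

  strictVoronoi-gap : StrictVoronoiD u → + 0 ≤ gap × (gap ≡ + 0 → w ≡ u ⊎ w ≡ neg u)
  strictVoronoi-gap (_ , _ , minimal) = gap≥0 , gap≡0⇒±u
    where
    gap≥0 : + 0 ≤ gap
    gap≥0 = ℤₚ.*-cancelˡ-≤-pos (+ 0) gap (+ 4)
      (subst (+ 0 ≤_) normSq-gap (ℤₚ.i≤j⇒0≤j-i (proj₁ (minimal v v∈D))))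
    gap≡0⇒±u : gap ≡ + 0 → w ≡ u ⊎ w ≡ neg u
    gap≡0⇒±u gap≡0 = proj₂ (minimal v v∈D) (ℤₚ.i-j≡0⇒i≡j _ _ (trans normSq-gap (cong (+ 4 *_) gap≡0)))

  ±u⇒root : ∣ lookup u i ∣ ≡ 1 → ∣ lookup u j ∣ ≡ 1 → w ≡ u ⊎ w ≡ neg u → IsRoot u
  ±u⇒root _ _ (inj₁ w≡u) = ⊥-elim (unit-nonzero a-unit (shift-injective (lookup u i)
    (trans (sym wᵢ) (trans (cong (λ x → lookup x i) w≡u) (sym (ℤₚ.+-identityʳ (lookup u i)))))))
  ±u⇒root ∣uᵢ∣≡1 ∣uⱼ∣≡1 (inj₂ w≡-u) =
    i , j , i≢j , ∣x∣≡1⇒unit _ ∣uᵢ∣≡1 , ∣x∣≡1⇒unit _ ∣uⱼ∣≡1 , λ m m≢i m≢j →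
      self-neg⇒0 (lookup u m)
        (trans (sym (w≈u m m≢i m≢j)) (trans (cong (λ x → lookup x m) w≡-u) (Vecₚ.lookup-map m -_ u)))

  opposed⇒root : StrictVoronoiD u → ∀ {k l} → ∣ lookup u i ∣ ≡ suc k → ∣ lookup u j ∣ ≡ suc l →
                 a * lookup u i ≡ -[1+ k ] → b * lookup u j ≡ -[1+ l ] → IsRoot u
  opposed⇒root sv {k} {l} ∣uᵢ∣≡1+k ∣uⱼ∣≡1+l auᵢ buⱼ =
    conclude (opposed-gaps-nonneg k l (subst (+ 0 ≤_) gap≡ (proj₁ (strictVoronoi-gap sv))))
    where
    gap≡ : gap ≡ (-[1+ k ] + + 1) + (-[1+ l ] + + 1)
    gap≡ = cong₂ (λ p q → (p + + 1) + (q + + 1)) auᵢ buⱼ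
    conclude : k ≡ 0 × l ≡ 0 → IsRoot u
    conclude (refl , refl) = ±u⇒root ∣uᵢ∣≡1+k ∣uⱼ∣≡1+l (proj₂ (strictVoronoi-gap sv) gap≡)

strictVoronoi-twoNonzero⇒root : (u : Pt n) → StrictVoronoiD u → i ≢ j →
                                lookup u i ≢ + 0 → lookup u j ≢ + 0 → IsRoot u
strictVoronoi-twoNonzero⇒root {i = i} {j} u sv i≢j uᵢ≢0 uⱼ≢0
  with opposing-unit (lookup u i) uᵢ≢0 | opposing-unit (lookup u j) uⱼ≢0
... | a , k , a-unit , ∣uᵢ∣≡1+k , auᵢ | b , l , b-unit , ∣uⱼ∣≡1+l , buⱼ =
  TestVector.opposed⇒root u i≢j a-unit b-unit sv ∣uᵢ∣≡1+k ∣uⱼ∣≡1+l auᵢ buⱼ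

another : (i : Fin (suc (suc n))) → ∃[ j ] j ≢ i
another zero    = suc zero , λ ()
another (suc _) = zero , λ ()

-- Here u = uᵢ eᵢ with uᵢ even, so testing at another coordinate j (where uⱼ = 0) gives gap = 2 − |uᵢ|;
-- hence |uᵢ| = 2, gap = 0 and u + 2v = ±u, which fails at j, where u + 2v has entry 2.
strictVoronoi-notSingle : (u : Pt (suc (suc n))) → StrictVoronoiD u → lookup u i ≢ + 0 → ¬ SupportedOn i u
strictVoronoi-notSingle {i = i} u sv uᵢ≢0 supp with opposing-unit (lookup u i) uᵢ≢0 | another i
... | a , k , a-unit , ∣uᵢ∣≡1+k , auᵢ | j , j≢i = ±u-impossible (proj₂ (strictVoronoi-gap sv) gap≡0)
  where
  open TestVector u (j≢i ∘ sym) a-unit (inj₁ refl)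
  uⱼ≡0 : lookup u j ≡ + 0
  uⱼ≡0 = supp j j≢i
  ∣uᵢ∣-even : Even (+ suc k)
  ∣uᵢ∣-even = subst Even (cong +_ ∣uᵢ∣≡1+k)
    (Signed.∣-trans (subst Even (sumℤ-supportedOn u supp) (InD⇒Even u (proj₁ sv))) Signed.m∣∣m∣)
  gap≡ : gap ≡ (-[1+ k ] + + 1) + + 1
  gap≡ = cong₂ (λ p q → (p + + 1) + (+ 1 * q + + 1)) auᵢ uⱼ≡0
  gap≡0 : gap ≡ + 0
  gap≡0 = trans gap≡ (even-opposed-gap k ∣uᵢ∣-even (subst (+ 0 ≤_) gap≡ (proj₁ (strictVoronoi-gap sv))))
  wⱼ≡2 : lookup w j ≡ + 2
  wⱼ≡2 = trans wⱼ (cong (λ t → t + + 2 * + 1) uⱼ≡0)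
  2≢0 : + 2 ≢ + 0
  2≢0 ()
  ±u-impossible : ¬ (w ≡ u ⊎ w ≡ neg u)
  ±u-impossible (inj₁ w≡u)  = 2≢0 (trans (sym wⱼ≡2) (trans (cong (λ x → lookup x j) w≡u) uⱼ≡0))
  ±u-impossible (inj₂ w≡-u) = 2≢0 (trans (sym wⱼ≡2) (trans (cong (λ x → lookup x j) w≡-u)
                                                          (trans (Vecₚ.lookup-map j -_ u) (cong -_ uⱼ≡0))))

strictVoronoi⇒root : (u : Pt (suc (suc n))) → StrictVoronoiD u → IsRoot u
strictVoronoi⇒root u sv@(_ , u≢0 , _) =
  let i , uᵢ≢0       = Finₚ.¬∀⟶∃¬ _ _ (λ m → lookup u m ℤ.≟ + 0) (u≢0 ∘ lookup-ext ∘ vanishing)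
      j , j≢i , uⱼ≢0 = ∃¬-except (λ m → lookup u m ℤ.≟ + 0) (strictVoronoi-notSingle u sv uᵢ≢0)
  in  strictVoronoi-twoNonzero⇒root u sv (j≢i ∘ sym) uᵢ≢0 uⱼ≢0
  where
  vanishing : (∀ m → lookup u m ≡ + 0) → ∀ m → lookup u m ≡ lookup zeroPt m
  vanishing u≗0 m = trans (u≗0 m) (sym (lookup-zeroPt m))


-- Vertices and edges of the half cube

bits-differ⇒unit : ∀ {p q} → IsBit p → IsBit q → p ≢ q → IsUnit (p - q)
bits-differ⇒unit (inj₁ refl) (inj₁ refl) p≢q = ⊥-elim (p≢q refl)
bits-differ⇒unit (inj₁ refl) (inj₂ refl) _   = inj₂ refl
bits-differ⇒unit (inj₂ refl) (inj₁ refl) _   = inj₁ refl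
bits-differ⇒unit (inj₂ refl) (inj₂ refl) p≢q = ⊥-elim (p≢q refl)

bit-complement-unique : ∀ {p q r} → IsBit p → IsBit q → IsBit r → p ≢ r → q ≢ r → p ≡ q
bit-complement-unique (inj₁ refl) (inj₁ refl) _           _   _   = refl
bit-complement-unique (inj₂ refl) (inj₂ refl) _           _   _   = refl
bit-complement-unique (inj₁ refl) (inj₂ refl) (inj₁ refl) p≢r _   = ⊥-elim (p≢r refl)
bit-complement-unique (inj₁ refl) (inj₂ refl) (inj₂ refl) _   q≢r = ⊥-elim (q≢r refl)
bit-complement-unique (inj₂ refl) (inj₁ refl) (inj₁ refl) _   q≢r = ⊥-elim (q≢r refl)
bit-complement-unique (inj₂ refl) (inj₁ refl) (inj₂ refl) p≢r _   = ⊥-elim (p≢r refl)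

face-≤ : ∀ {p q z} → IsBit p → IsBit q → IsBit z → (p + q - + 1) * z ≤ (p + q - + 1) * p
face-≤ (inj₁ refl) (inj₁ refl) (inj₁ refl) = ℤₚ.≤-refl
face-≤ (inj₁ refl) (inj₁ refl) (inj₂ refl) = -≤+
face-≤ (inj₁ refl) (inj₂ refl) _           = ℤₚ.≤-refl
face-≤ (inj₂ refl) (inj₁ refl) _           = ℤₚ.≤-refl
face-≤ (inj₂ refl) (inj₂ refl) (inj₁ refl) = +≤+ ℕ.z≤n
face-≤ (inj₂ refl) (inj₂ refl) (inj₂ refl) = ℤₚ.≤-refl

face-sym : ∀ {p q} → IsBit p → IsBit q → (p + q - + 1) * p ≡ (p + q - + 1) * q
face-sym (inj₁ refl) (inj₁ refl) = refl
face-sym (inj₁ refl) (inj₂ refl) = refl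
face-sym (inj₂ refl) (inj₁ refl) = refl
face-sym (inj₂ refl) (inj₂ refl) = refl

face-≡ : ∀ {p z} → IsBit p → IsBit z → (p + p - + 1) * z ≡ (p + p - + 1) * p → z ≡ p
face-≡ (inj₁ refl) (inj₁ refl) _  = refl
face-≡ (inj₂ refl) (inj₂ refl) _  = refl
face-≡ (inj₁ refl) (inj₂ refl) ()
face-≡ (inj₂ refl) (inj₁ refl) ()

-- The coefficient x_m + y_m − 1 is 0 where x and y differ and ±1 (pointing towards x_m) where they
-- agree, so on {0,1}ⁿ the functional c·_ is maximal exactly on the points that agree with x wherever
-- x and y agree: the smallest face of the cube containing x and y.
faceFunctional : Pt n → Pt n → Pt n
faceFunctional = zipWith (λ p q → p + q - + 1)

module FaceFunctional (x y : Pt n) (x-bits : All IsBit x) (y-bits : All IsBit y) where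

  c : Pt n
  c = faceFunctional x y

  lookup-c* : ∀ (z : Pt n) m → lookup (zipWith _*_ c z) m ≡ (lookup x m + lookup y m - + 1) * lookup z m
  lookup-c* z m = trans (Vecₚ.lookup-zipWith _*_ m c z)
    (cong (_* lookup z m) (Vecₚ.lookup-zipWith (λ p q → p + q - + 1) m x y))

  c·x≡c·y : c · x ≡ c · y
  c·x≡c·y = cong sumℤ (lookup-ext {x = zipWith _*_ c x} {zipWith _*_ c y} λ m →
    trans (lookup-c* x m) (trans (face-sym (lookup⁺ x-bits m) (lookup⁺ y-bits m)) (sym (lookup-c* y m))))

  module _ (z : Pt n) (z-bits : All IsBit z) where

    private
      products-≤ : ∀ m → lookup (zipWith _*_ c z) m ≤ lookup (zipWith _*_ c x) m
      products-≤ m = subst₂ _≤_ (sym (lookup-c* z m)) (sym (lookup-c* x m))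
        (face-≤ (lookup⁺ x-bits m) (lookup⁺ y-bits m) (lookup⁺ z-bits m))

    c·z≤c·x : c · z ≤ c · x
    c·z≤c·x = sumℤ-mono-≤ (zipWith _*_ c z) (zipWith _*_ c x) products-≤

    c·z≡c·x⇒agree : c · z ≡ c · x → ∀ m → lookup x m ≡ lookup y m → lookup z m ≡ lookup x m
    c·z≡c·x⇒agree eq m xₘ≡yₘ = face-≡ (lookup⁺ x-bits m) (lookup⁺ z-bits m)
      (subst (λ q → (lookup x m + q - + 1) * lookup z m ≡ (lookup x m + q - + 1) * lookup x m) (sym xₘ≡yₘ)
        (trans (sym (lookup-c* z m)) (trans (products-equal m) (lookup-c* x m))))
      where
      products-equal : ∀ m → lookup (zipWith _*_ c z) m ≡ lookup (zipWith _*_ c x) m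
      products-equal = sumℤ-mono-≤-≡ (zipWith _*_ c z) (zipWith _*_ c x) products-≤ eq

generator⇒vertex : (x : Pt n) → HGen x → HVertex x
generator⇒vertex x x-gen@(x-bits , _) =
  x-gen , c , c · x , refl , λ z (z-bits , _) →
    c·z≤c·x z z-bits , λ eq → lookup-ext λ m → c·z≡c·x⇒agree z z-bits eq m refl
  where open FaceFunctional x x x-bits x-bits

Hamming₂ : Pt n → Pt n → Set
Hamming₂ {n} x y =
  ∃[ i ] ∃[ j ] i ≢ j × lookup x i ≢ lookup y i × lookup x j ≢ lookup y j × EqualExcept₂ i j x y

hamming₂⇒edge : (x y : Pt n) → HGen x → HGen y → Hamming₂ x y → HEdge x y
hamming₂⇒edge x y x-gen@(x-bits , x∈D) y-gen@(y-bits , _) (i , j , i≢j , xᵢ≢yᵢ , xⱼ≢yⱼ , x≈y) =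
  (λ x≡y → xᵢ≢yᵢ (cong (λ v → lookup v i) x≡y)) , x-gen , y-gen , c , c · x , refl , sym c·x≡c·y ,
  λ z z-gen → c·z≤c·x z (proj₁ z-gen) , on-face z z-gen
  where
  open FaceFunctional x y x-bits y-bits
  on-face : ∀ z → HGen z → c · z ≡ c · x → z ≡ x ⊎ z ≡ y
  on-face z (z-bits , z∈D) eq = decide (lookup z i ℤ.≟ lookup x i) (lookup z j ℤ.≟ lookup x j)
    where
    z≈x : EqualExcept₂ i j z x
    z≈x m m≢i m≢j = c·z≡c·x⇒agree z z-bits eq m (x≈y m m≢i m≢j)
    parity : Even ((lookup z i - lookup x i) + (lookup z j - lookup x j))
    parity = InD-equalExcept₂-even z x z∈D x∈D i≢j z≈x
    flipped : ∀ m → lookup z m ≢ lookup x m → lookup x m ≢ lookup y m → lookup z m ≡ lookup y m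
    flipped m zₘ≢xₘ xₘ≢yₘ =
      bit-complement-unique (lookup⁺ z-bits m) (lookup⁺ y-bits m) (lookup⁺ x-bits m) zₘ≢xₘ (xₘ≢yₘ ∘ sym)
    flip-unit : ∀ m → lookup z m ≢ lookup x m → IsUnit (lookup z m - lookup x m)
    flip-unit m = bits-differ⇒unit (lookup⁺ z-bits m) (lookup⁺ x-bits m)
    decide : Dec (lookup z i ≡ lookup x i) → Dec (lookup z j ≡ lookup x j) → z ≡ x ⊎ z ≡ y
    decide (yes zᵢ≡xᵢ) (yes zⱼ≡xⱼ) = inj₁ (lookup-ext (∀-split₂ zᵢ≡xᵢ zⱼ≡xⱼ z≈x))
    decide (no zᵢ≢xᵢ)  (no zⱼ≢xⱼ)  = inj₂ (lookup-ext
      (∀-split₂ (flipped i zᵢ≢xᵢ xᵢ≢yᵢ) (flipped j zⱼ≢xⱼ xⱼ≢yⱼ) λ m m≢i m≢j →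
        trans (z≈x m m≢i m≢j) (x≈y m m≢i m≢j)))
    decide (yes zᵢ≡xᵢ) (no zⱼ≢xⱼ)  =
      ⊥-elim (¬Even-0+unit (ℤₚ.i≡j⇒i-j≡0 zᵢ≡xᵢ) (flip-unit j zⱼ≢xⱼ) parity)
    decide (no zᵢ≢xᵢ)  (yes zⱼ≡xⱼ) =
      ⊥-elim (¬Even-unit+0 (flip-unit i zᵢ≢xᵢ) (ℤₚ.i≡j⇒i-j≡0 zⱼ≡xⱼ) parity)

swap₂ : Fin n → Fin n → Pt n → Pt n → Pt n
swap₂ i j x y = x [ i ]≔ lookup y i [ j ]≔ lookup y j

swap₂-generator : (x y : Pt n) → HGen x → HGen y → i ≢ j →
                  lookup x i ≢ lookup y i → lookup x j ≢ lookup y j → HGen (swap₂ i j x y)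
swap₂-generator {i = i} {j} x y (x-bits , x∈D) (y-bits , _) i≢j xᵢ≢yᵢ xⱼ≢yⱼ =
  lookup⁻ (∀-split₂ (subst IsBit (sym zᵢ) (lookup⁺ y-bits i)) (subst IsBit (sym zⱼ) (lookup⁺ y-bits j))
    λ m m≢i m≢j → subst IsBit (sym (z≈x m m≢i m≢j)) (lookup⁺ x-bits m)) ,
  Even⇒InD z (even-by-difference (subst Even (sym difference) flips-even) (InD⇒Even x x∈D))
  where
  z : Pt _
  z = swap₂ i j x y
  zᵢ : lookup z i ≡ lookup y i
  zᵢ = lookup∘update₂ˡ x i≢j
  zⱼ : lookup z j ≡ lookup y j
  zⱼ = lookup∘update₂ʳ x
  z≈x : EqualExcept₂ i j z x
  z≈x = update₂-equalExcept₂ x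
  difference : sumℤ z - sumℤ x ≡ (lookup y i - lookup x i) + (lookup y j - lookup x j)
  difference = trans (sumℤ-equalExcept₂ z x i≢j z≈x)
    (cong₂ (λ p q → (p - lookup x i) + (q - lookup x j)) zᵢ zⱼ)
  flips-even : Even ((lookup y i - lookup x i) + (lookup y j - lookup x j))
  flips-even = unit+unit-even
    (bits-differ⇒unit (lookup⁺ y-bits i) (lookup⁺ x-bits i) (xᵢ≢yᵢ ∘ sym))
    (bits-differ⇒unit (lookup⁺ y-bits j) (lookup⁺ x-bits j) (xⱼ≢yⱼ ∘ sym))

swap₂-⊕ : (x y : Pt n) → i ≢ j → swap₂ i j x y ⊕ swap₂ i j y x ≡ x ⊕ y
swap₂-⊕ {i = i} {j} x y i≢j = lookup-ext λ m → begin
  lookup (z ⊕ z′) m            ≡⟨ Vecₚ.lookup-zipWith _+_ m z z′ ⟩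
  lookup z m + lookup z′ m     ≡⟨ ∀-split₂ {P = Sums-agree} atᵢ atⱼ off m ⟩
  lookup x m + lookup y m      ≡⟨ Vecₚ.lookup-zipWith _+_ m x y ⟨
  lookup (x ⊕ y) m             ∎
  where
  open ≡-Reasoning
  z z′ : Pt _
  z = swap₂ i j x y
  z′ = swap₂ i j y x
  Sums-agree : Fin _ → Set
  Sums-agree m = lookup z m + lookup z′ m ≡ lookup x m + lookup y m
  atᵢ : Sums-agree i
  atᵢ = trans (cong₂ _+_ (lookup∘update₂ˡ x i≢j) (lookup∘update₂ˡ y i≢j)) (ℤₚ.+-comm (lookup y i) (lookup x i))
  atⱼ : Sums-agree j
  atⱼ = trans (cong₂ _+_ (lookup∘update₂ʳ x) (lookup∘update₂ʳ y)) (ℤₚ.+-comm (lookup y j) (lookup x j))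
  off : ∀ m → m ≢ i → m ≢ j → Sums-agree m
  off m m≢i m≢j = cong₂ _+_ (update₂-equalExcept₂ x m m≢i m≢j) (update₂-equalExcept₂ y m m≢i m≢j)

-- If x and y also differed at k, exchanging their i- and j-entries would give two generators z, z′
-- with c·z + c·z′ = c·x + c·y, so both lie on the supporting face; but z differs from x at i and from
-- y at k.
edge-agreesOff₂ : (x y : Pt n) → HEdge x y → i ≢ j → lookup x i ≢ lookup y i → lookup x j ≢ lookup y j →
                  EqualExcept₂ i j x y
edge-agreesOff₂ {i = i} {j} x y (_ , x-gen , y-gen , c , δ , c·x≡δ , c·y≡δ , supporting) i≢j xᵢ≢yᵢ xⱼ≢yⱼ
                k k≢i k≢j =
  decidable-stable (lookup x k ℤ.≟ lookup y k) λ xₖ≢yₖ → off-face xₖ≢yₖ (proj₂ (supporting z z-gen) c·z≡δ)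
  where
  z z′ : Pt _
  z = swap₂ i j x y
  z′ = swap₂ i j y x
  z-gen : HGen z
  z-gen = swap₂-generator x y x-gen y-gen i≢j xᵢ≢yᵢ xⱼ≢yⱼ
  z′-gen : HGen z′
  z′-gen = swap₂-generator y x y-gen x-gen i≢j (xᵢ≢yᵢ ∘ sym) (xⱼ≢yⱼ ∘ sym)
  c·z≡δ : c · z ≡ δ
  c·z≡δ = proj₁ (+-mono-≤-≡ (proj₁ (supporting z z-gen)) (proj₁ (supporting z′ z′-gen)) (begin
    c · z + c · z′   ≡⟨ ·-distribˡ-⊕ c z z′ ⟨
    c · (z ⊕ z′)     ≡⟨ cong (c ·_) (swap₂-⊕ x y i≢j) ⟩
    c · (x ⊕ y)      ≡⟨ ·-distribˡ-⊕ c x y ⟩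
    c · x + c · y    ≡⟨ cong₂ _+_ c·x≡δ c·y≡δ ⟩
    δ + δ            ∎))
    where open ≡-Reasoning
  off-face : lookup x k ≢ lookup y k → ¬ (z ≡ x ⊎ z ≡ y)
  off-face _     (inj₁ z≡x) = xᵢ≢yᵢ (trans (sym (cong (λ v → lookup v i) z≡x)) (lookup∘update₂ˡ x i≢j))
  off-face xₖ≢yₖ (inj₂ z≡y) =
    xₖ≢yₖ (trans (sym (update₂-equalExcept₂ x k k≢i k≢j)) (cong (λ v → lookup v k) z≡y))

edge⇒hamming₂ : (x y : Pt n) → HEdge x y → Hamming₂ x y
edge⇒hamming₂ x y edge@(x≢y , (x-bits , x∈D) , (y-bits , y∈D) , _) =
  let i , xᵢ≢yᵢ       = Finₚ.¬∀⟶∃¬ _ _ (λ m → lookup x m ℤ.≟ lookup y m) (x≢y ∘ lookup-ext)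
      j , j≢i , xⱼ≢yⱼ = ∃¬-except (λ m → lookup x m ℤ.≟ lookup y m) λ x≈y →
        unit-odd (bits-differ⇒unit (lookup⁺ x-bits i) (lookup⁺ y-bits i) xᵢ≢yᵢ)
                 (InD-equalExcept-even x y x∈D y∈D x≈y)
  in  i , j , j≢i ∘ sym , xᵢ≢yᵢ , xⱼ≢yⱼ , edge-agreesOff₂ x y edge (j≢i ∘ sym) xᵢ≢yᵢ xⱼ≢yⱼ

hamming₂⇒root : (x y : Pt n) → All IsBit x → All IsBit y → Hamming₂ x y → IsRoot (x ⊖ y)
hamming₂⇒root x y x-bits y-bits (i , j , i≢j , xᵢ≢yᵢ , xⱼ≢yⱼ , x≈y) =
  i , j , i≢j , unit-at i xᵢ≢yᵢ , unit-at j xⱼ≢yⱼ ,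
  λ m m≢i m≢j → trans (lookup-⊖ x y m) (ℤₚ.i≡j⇒i-j≡0 (x≈y m m≢i m≢j))
  where
  unit-at : ∀ m → lookup x m ≢ lookup y m → IsUnit (lookup (x ⊖ y) m)
  unit-at m xₘ≢yₘ =
    subst IsUnit (sym (lookup-⊖ x y m)) (bits-differ⇒unit (lookup⁺ x-bits m) (lookup⁺ y-bits m) xₘ≢yₘ)


-- The parity map ℤⁿ → {0,1}ⁿ

parity : ℤ → ℤ
parity a = + (a %ℕ 2)

parity-bit : ∀ a → IsBit (parity a)
parity-bit a with a %ℕ 2 | n%ℕd<d a 2
... | 0           | _                  = inj₁ refl
... | 1           | _                  = inj₂ refl
... | suc (suc _) | ℕ.s≤s (ℕ.s≤s ())

parity-even : ∀ a → Even (parity a - a)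
parity-even a = subst (λ t → Even (parity a - t)) (sym (a≡a%ℕn+[a/ℕn]*n a 2))
  (subst Even (sym (cancel (parity a) (a /ℕ 2))) (Signed.∣n⇒∣m*n (- (a /ℕ 2)) Signed.∣-refl))
  where
  cancel : ∀ r q → r - (r + q * + 2) ≡ - q * + 2
  cancel = solve-∀

parity-≡⇒even : parity a ≡ parity b → Even (a - b)
parity-≡⇒even {a} {b} eq = subst Even (regroup (parity b) a b)
  (Signed.∣m∣n⇒∣m-n (parity-even b) (subst (λ p → Even (p - a)) eq (parity-even a)))
  where
  regroup : ∀ p a b → (p - b) - (p - a) ≡ a - b
  regroup = solve-∀

lookup-parity : ∀ (x : Pt n) m → lookup (map parity x) m ≡ parity (lookup x m)
lookup-parity x m = Vecₚ.lookup-map m parity x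

parity-generator : (x : Pt n) → InD x → HGen (map parity x)
parity-generator x x∈D =
  lookup⁻ (λ m → subst IsBit (sym (lookup-parity x m)) (parity-bit (lookup x m))) ,
  Even⇒InD (map parity x) (even-by-difference
    (sumℤ-difference-even (map parity x) x λ m →
      subst (λ p → Even (p - lookup x m)) (sym (lookup-parity x m)) (parity-even (lookup x m)))
    (InD⇒Even x x∈D))

root⇒parityHamming₂ : (x y : Pt n) → IsRoot (x ⊖ y) → Hamming₂ (map parity x) (map parity y)
root⇒parityHamming₂ x y (i , j , i≢j , dᵢ , dⱼ , supp) = i , j , i≢j , differ i dᵢ , differ j dⱼ , agree
  where
  differ : ∀ m → IsUnit (lookup (x ⊖ y) m) → lookup (map parity x) m ≢ lookup (map parity y) m
  differ m dₘ eq = unit-odd (subst IsUnit (lookup-⊖ x y m) dₘ)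
    (parity-≡⇒even {lookup x m} {lookup y m} (trans (sym (lookup-parity x m)) (trans eq (lookup-parity y m))))
  agree : EqualExcept₂ i j (map parity x) (map parity y)
  agree m m≢i m≢j = begin
    lookup (map parity x) m  ≡⟨ lookup-parity x m ⟩
    parity (lookup x m)      ≡⟨ cong parity (ℤₚ.i-j≡0⇒i≡j (lookup x m) (lookup y m) xₘ-yₘ≡0) ⟩
    parity (lookup y m)      ≡⟨ lookup-parity y m ⟨
    lookup (map parity y) m  ∎
    where
    open ≡-Reasoning
    xₘ-yₘ≡0 : lookup x m - lookup y m ≡ + 0
    xₘ-yₘ≡0 = trans (sym (lookup-⊖ x y m)) (supp m m≢i m≢j)

ColorableD⇒ColorableHalfCube : ∀ {n k} → ColorableD n k → ColorableHalfCube n k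
ColorableD⇒ColorableHalfCube (colour , proper) =
  colour , λ x y ((x-bits , x∈D) , _) ((y-bits , y∈D) , _) edge →
    proper x y x∈D y∈D (root⇒strictVoronoi (x ⊖ y) (hamming₂⇒root x y x-bits y-bits (edge⇒hamming₂ x y edge)))

ColorableHalfCube⇒ColorableD : ∀ {n k} → ColorableHalfCube (suc (suc n)) k → ColorableD (suc (suc n)) k
ColorableHalfCube⇒ColorableD (colour , proper) = colour ∘ map parity , λ x y x∈D y∈D strict →
  proper (map parity x) (map parity y) (vertex x∈D) (vertex y∈D)
    (hamming₂⇒edge (map parity x) (map parity y) (parity-generator x x∈D) (parity-generator y y∈D)
      (root⇒parityHamming₂ x y (strictVoronoi⇒root (x ⊖ y) strict)))
  where
  vertex : ∀ {x} → InD x → HVertex (map parity x)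
  vertex {x} x∈D = generator⇒vertex (map parity x) (parity-generator x x∈D)

mainTheorem9 : ∀ (n : ℕ) → 4 ℕ.≤ n → ∀ (k : ℕ) →
    (ColorableD n k → ColorableHalfCube n k) × (ColorableHalfCube n k → ColorableD n k)
mainTheorem9 _ (ℕ.s≤s (ℕ.s≤s _)) _ = ColorableD⇒ColorableHalfCube , ColorableHalfCube⇒ColorableD
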